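{- Let $n$ and $q$ be integers with $n\geq 2$ and $q\geq 2$. Let $C(n,q)$ be the maximum number of codewords in a non-overlapping $q$-ary code of length $n$. Then \[ C(n,q)<\frac{q^n}{2n-1}. \]
   Context: Let $F$ be a finite alphabet with $|F|=q$. Two words $u,v\in F^n$ (not necessarily distinct) are overlapping if a non-empty proper prefix of $u$ equals a non-empty proper suffix of $v$, or a non-empty proper prefix of $v$ equals a non-empty proper suffix of $u$. A code $C\subseteq F^n$ is non-overlapping if for all (not necessarily distinct) $u,v\in C$, the words $u$ and $v$ are not overlapping. $C(n,q)$ denotes the maximum cardinality of a non-overlapping code $C\subseteq F^n$ with $|F|=q$. -}

module Defs where

open import Data.Nat using (ℕ; _≤_; _<_; _∸_)
open import Data.Fin using (Fin)
open import Data.Vec using (Vec; toList)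
open import Data.List using (List; take; drop)
open import Data.List.Membership.Propositional using (_∈_)
open import Data.Product using (Σ; _×_)
open import Data.Sum using (_⊎_)
open import Relation.Binary.PropositionalEquality using (_≡_)
open import Relation.Nullary using (¬_)

Word : ℕ → ℕ → Set
Word q n = Vec (Fin q) n

PrefixSuffix : ∀ {q n} → ℕ → Word q n → Word q n → Set
PrefixSuffix {n = n} k u v = take k (toList u) ≡ drop (n ∸ k) (toList v)

Overlapping : ∀ {q n} → Word q n → Word q n → Set
Overlapping {n = n} u v =
  Σ ℕ (λ k → (1 ≤ k × k < n) × (PrefixSuffix k u v ⊎ PrefixSuffix k v u))

NonOverlapping : ∀ {q n} → List (Word q n) → Set
NonOverlapping {q} {n} C = ∀ (u v : Word q n) → u ∈ C → v ∈ C → ¬ Overlapping u v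

-- Let C be a non-overlapping code of length n and let m < n.  Glue a codeword c ∈ C to an
-- arbitrary tail t ∈ F^m and rotate the resulting word of length L = n + m cyclically by
-- some s < L.  If two such rotations coincide, both codewords sit as windows of length n in
-- the same cyclic word of length L < 2n; windows at different positions are less than n
-- apart in one of the two directions around the cycle, so the codewords overlap.  Hence
-- (c, t, s) is determined by its rotation.  No rotation is a constant word, since a constant
-- codeword of length n ≥ 2 overlaps itself.  Therefore |C| · L · q^m < q^L, i.e.
-- |C| · (n + m) < q^n, and m = n − 1 gives the theorem.
module Submission where

open import Defs
open import Data.Nat using (ℕ; _≤_; _<_; _*_; _^_; _∸_)
open import Data.List using (List; length)
open import Data.List.Relation.Unary.Unique.Propositional using (Unique)

open import Data.Nat using (zero; suc; _+_; _⊓_; z<s; _<?_)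
open import Data.Nat.Properties
open import Data.Nat.Tactic.RingSolver using (solve-∀)
open import Data.Fin as Fin using (Fin; toℕ; combine; remQuot; fromℕ<)
open import Data.Fin.Properties using (toℕ-injective; toℕ<n; combine-injective; injective⇒≤; *↔×)
open import Data.Vec using (toList)
open import Data.Vec.Properties using (toList-injective; length-toList)
open import Data.Vec.Relation.Binary.Equality.Cast using (cast-is-id)
open import Data.List using ([]; _∷_; _++_; take; drop; replicate; lookup)
open import Data.List.Properties
open import Data.List.Relation.Unary.All as All using (All)
open import Data.List.Relation.Unary.All.Properties using (take⁺; drop⁺; ++⁺; replicate⁺)
open import Data.List.Relation.Unary.AllPairs using (_∷_)
open import Data.List.Membership.Propositional.Properties using (∈-lookup)
open import Data.Product using (∃-syntax; _×_; _,_; proj₁; proj₂; map₁)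
open import Data.Sum using (_⊎_; inj₁; inj₂; [_,_])
open import Data.Empty using (⊥-elim)
open import Function.Base using (_$_)
open import Function.Bundles using (Injection)
open import Function.Definitions using (Injective)
open import Function.Properties.Inverse using (↔⇒↣)
open import Relation.Binary.Definitions using (tri<; tri≈; tri>)
open import Relation.Binary.PropositionalEquality
  using (_≡_; _≢_; refl; sym; trans; cong; cong₂; subst; subst₂; module ≡-Reasoning)
open import Relation.Nullary using (¬_; Dec; yes; no; contradiction)

m<n⇒∃[o]m+suc[o]≡n : ∀ {m n} → m < n → ∃[ o ] m + suc o ≡ n
m<n⇒∃[o]m+suc[o]≡n {m} m<n = let (o , eq) = m≤n⇒∃[o]m+o≡n m<n in o , trans (+-suc m o) eq

module _ {A : Set} where

  take-length-++ : (xs ys : List A) → take (length xs) (xs ++ ys) ≡ xs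
  take-length-++ []       ys = refl
  take-length-++ (x ∷ xs) ys = cong (x ∷_) (take-length-++ xs ys)

  drop-length-++ : (xs ys : List A) → drop (length xs) (xs ++ ys) ≡ ys
  drop-length-++ []       ys = refl
  drop-length-++ (x ∷ xs) ys = drop-length-++ xs ys

  ++-injective : (xs ys xs′ ys′ : List A) → length xs ≡ length xs′ →
                 xs ++ ys ≡ xs′ ++ ys′ → xs ≡ xs′ × ys ≡ ys′
  ++-injective []       ys []         ys′ _   eq = refl , eq
  ++-injective (x ∷ xs) ys (x′ ∷ xs′) ys′ len eq =
    let (xs≡ , ys≡) = ++-injective xs ys xs′ ys′ (suc-injective len) (∷-injectiveʳ eq)
    in cong₂ _∷_ (∷-injectiveˡ eq) xs≡ , ys≡

  all≡⇒≡replicate : ∀ {a} {xs : List A} → All (_≡ a) xs → xs ≡ replicate (length xs) a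
  all≡⇒≡replicate All.[]         = refl
  all≡⇒≡replicate (refl All.∷ ps) = cong (_ ∷_) (all≡⇒≡replicate ps)

  rotate : ℕ → List A → List A
  rotate s w = drop s w ++ take s w

  length-rotate : ∀ s (w : List A) → length (rotate s w) ≡ length w
  length-rotate s w = trans (length-++-comm (drop s w) (take s w)) (cong length (take++drop≡id s w))

  -- A record rather than an equation, so that u, i and D can be inferred from it.
  record OccursAt (u : List A) (i : ℕ) (D : List A) : Set where
    constructor occurs
    field window : take (length u) (drop i D) ≡ u

  occursAt-unique : ∀ {u v i D} → length u ≡ length v → OccursAt u i D → OccursAt v i D → u ≡ v
  occursAt-unique {i = i} {D} len (occurs u-at) (occurs v-at) =
    trans (sym u-at) (trans (cong (λ k → take k (drop i D)) len) v-at)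

  occursAt-prefix : ∀ {c} t {i D} → OccursAt (c ++ t) i D → OccursAt c i D
  occursAt-prefix {c} t {i} {D} (occurs ct-at) = occurs $ begin
    take (length c) (drop i D)
      ≡⟨ cong (λ k → take k (drop i D)) (sym (m≤n⇒m⊓n≡m (length-++-≤ˡ c))) ⟩
    take (length c ⊓ length (c ++ t)) (drop i D)
      ≡⟨ sym (take-take (length c) (length (c ++ t)) (drop i D)) ⟩
    take (length c) (take (length (c ++ t)) (drop i D))
      ≡⟨ cong (take (length c)) ct-at ⟩
    take (length c) (c ++ t)
      ≡⟨ take-length-++ c t ⟩
    c ∎
    where open ≡-Reasoning

  occursAt-++ : ∀ {u i E} X → OccursAt u i E → OccursAt u (length X + i) (X ++ E)
  occursAt-++ {u} {i} {E} X (occurs u-at) = occurs $ begin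
    take (length u) (drop (length X + i) (X ++ E))
      ≡⟨ cong (take (length u)) (sym (drop-drop (length X) i (X ++ E))) ⟩
    take (length u) (drop i (drop (length X) (X ++ E)))
      ≡⟨ cong (λ ys → take (length u) (drop i ys)) (drop-length-++ X E) ⟩
    take (length u) (drop i E)
      ≡⟨ u-at ⟩
    u ∎
    where open ≡-Reasoning

  Overlaps : ℕ → List A → List A → Set
  Overlaps n u v = ∃[ k ] (1 ≤ k × k < n) × take k u ≡ drop (n ∸ k) v

  occursAt-overlaps : ∀ {n u v i e D} → length u ≡ n → length v ≡ n → 0 < e → e < n →
                      OccursAt u i D → OccursAt v (i + e) D → Overlaps n v u
  occursAt-overlaps {n} {u} {v} {i} {e} {D} refl lv 0<e e<n (occurs u-at) (occurs v-at) =
    n ∸ e , (m<n⇒0<n∸m e<n , ∸-monoʳ-< 0<e (<⇒≤ e<n)) , prefix≡suffix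
    where
    open ≡-Reasoning
    prefix≡suffix : take (n ∸ e) v ≡ drop (n ∸ (n ∸ e)) u
    prefix≡suffix = begin
      take (n ∸ e) v
        ≡⟨ cong (take (n ∸ e)) (sym v-at) ⟩
      take (n ∸ e) (take (length v) (drop (i + e) D))
        ≡⟨ take-take (n ∸ e) (length v) _ ⟩
      take ((n ∸ e) ⊓ length v) (drop (i + e) D)
        ≡⟨ cong (λ k → take ((n ∸ e) ⊓ k) (drop (i + e) D)) lv ⟩
      take ((n ∸ e) ⊓ n) (drop (i + e) D)
        ≡⟨ cong (λ k → take k (drop (i + e) D)) (m≤n⇒m⊓n≡m (m∸n≤m n e)) ⟩
      take (n ∸ e) (drop (i + e) D)
        ≡⟨ cong (take (n ∸ e)) (sym (drop-drop i e D)) ⟩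
      take (n ∸ e) (drop e (drop i D))
        ≡⟨ take-drop (n ∸ e) e (drop i D) ⟩
      drop e (take (e + (n ∸ e)) (drop i D))
        ≡⟨ cong (λ k → drop e (take k (drop i D))) (m+[n∸m]≡n (<⇒≤ e<n)) ⟩
      drop e (take n (drop i D))
        ≡⟨ cong (drop e) u-at ⟩
      drop e u
        ≡⟨ cong (λ k → drop k u) (sym (m∸[m∸n]≡n (<⇒≤ e<n))) ⟩
      drop (n ∸ (n ∸ e)) u ∎

  occursAt-rotate : ∀ w s p zs → length w ≡ s + p →
                    OccursAt w p (rotate s w ++ rotate s w ++ zs)
  occursAt-rotate w s p zs len = occurs $ begin
    take (length w) (drop p ((drop s w ++ take s w) ++ rotate s w ++ zs))
      ≡⟨ cong (λ ys → take (length w) (drop p ys)) (++-assoc (drop s w) (take s w) _) ⟩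
    take (length w) (drop p (drop s w ++ take s w ++ rotate s w ++ zs))
      ≡⟨ cong (λ k → take (length w) (drop k (drop s w ++ _))) (sym p≡) ⟩
    take (length w) (drop (length (drop s w)) (drop s w ++ take s w ++ rotate s w ++ zs))
      ≡⟨ cong (take (length w)) (drop-length-++ (drop s w) _) ⟩
    take (length w) (take s w ++ (drop s w ++ take s w) ++ zs)
      ≡⟨ cong (λ ys → take (length w) (take s w ++ ys)) (++-assoc (drop s w) (take s w) zs) ⟩
    take (length w) (take s w ++ drop s w ++ take s w ++ zs)
      ≡⟨ cong (take (length w)) (sym (++-assoc (take s w) (drop s w) _)) ⟩
    take (length w) ((take s w ++ drop s w) ++ take s w ++ zs)
      ≡⟨ cong (λ ys → take (length w) (ys ++ take s w ++ zs)) (take++drop≡id s w) ⟩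
    take (length w) (w ++ take s w ++ zs)
      ≡⟨ take-length-++ w _ ⟩
    w ∎
    where
    open ≡-Reasoning
    p≡ : length (drop s w) ≡ p
    p≡ = trans (length-drop s w) (trans (cong (_∸ s) len) (m+n∸m≡n s p))

  occursAt-rotate-next : ∀ w s p → length w ≡ s + p →
                         OccursAt w (length w + p) (rotate s w ++ rotate s w ++ rotate s w)
  occursAt-rotate-next w s p len =
    subst (λ k → OccursAt w (k + p) (X ++ X ++ X)) (length-rotate s w)
      (occursAt-++ X (subst (OccursAt w p) (cong (X ++_) (++-identityʳ X)) (occursAt-rotate w s p [] len)))
    where X = rotate s w

  rotate-injective : ∀ {s} w w′ → length w ≡ length w′ → s ≤ length w →
                     rotate s w ≡ rotate s w′ → w ≡ w′
  rotate-injective {s} w w′ len s≤ eq =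
    let (p , s+p≡) = m≤n⇒∃[o]m+o≡n s≤
    in occursAt-unique len (occursAt-rotate w s p [] (sym s+p≡))
         (subst (OccursAt w′ p) (cong (λ X → X ++ X ++ []) (sym eq))
           (occursAt-rotate w′ s p [] (trans (sym len) (sym s+p≡))))

  -- Two windows of length n in a cycle of length s + e + r, at distance e one way round
  -- and s + r the other way; one of the two distances is below n because the cycle is
  -- shorter than 2n.
  distinct-rotations-overlap : ∀ {n} c t c′ t′ {s e r} → 0 < e → 0 < r →
    length c ≡ n → length c′ ≡ n → length t < n →
    length (c ++ t) ≡ s + e + r → length (c′ ++ t′) ≡ s + e + r →
    rotate s (c ++ t) ≡ rotate (s + e) (c′ ++ t′) →
    Overlaps n c c′ ⊎ Overlaps n c′ c
  distinct-rotations-overlap {n} c t c′ t′ {s} {e} {r} 0<e 0<r lc lc′ lt lw lw′ eq =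
    by-cases (e <? n)
    where
    next-lap : ∀ s e r → s + e + r + r ≡ e + r + (s + r)
    next-lap = solve-∀

    swap-last : ∀ s r e → s + r + e ≡ s + e + r
    swap-last = solve-∀

    X  = rotate s (c ++ t)
    X′ = rotate (s + e) (c′ ++ t′)
    D  = X ++ X ++ X

    D≡ : X′ ++ X′ ++ X′ ≡ D
    D≡ = cong (λ Y → Y ++ Y ++ Y) (sym eq)

    c-at : OccursAt c (e + r) D
    c-at = occursAt-prefix t (occursAt-rotate (c ++ t) s (e + r) X (trans lw (+-assoc s e r)))

    c′-at : OccursAt c′ r D
    c′-at = subst (OccursAt c′ r) D≡
      (occursAt-prefix t′ (occursAt-rotate (c′ ++ t′) (s + e) r X′ lw′))

    c′-at-next : OccursAt c′ (e + r + (s + r)) D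
    c′-at-next = subst₂ (OccursAt c′) (trans (cong (_+ r) lw′) (next-lap s e r)) D≡
      (occursAt-prefix t′ (occursAt-rotate-next (c′ ++ t′) (s + e) r lw′))

    s+r<n : n ≤ e → s + r < n
    s+r<n n≤e = +-cancelʳ-< n (s + r) n (begin-strict
      s + r + n           ≤⟨ +-monoʳ-≤ (s + r) n≤e ⟩
      s + r + e           ≡⟨ swap-last s r e ⟩
      s + e + r           ≡⟨ sym lw ⟩
      length (c ++ t)     ≡⟨ length-++ c ⟩
      length c + length t <⟨ +-monoʳ-< (length c) lt ⟩
      length c + n        ≡⟨ cong (_+ n) lc ⟩
      n + n               ∎)
      where open ≤-Reasoning

    by-cases : Dec (e < n) → Overlaps n c c′ ⊎ Overlaps n c′ c
    by-cases (yes e<n) =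
      inj₁ (occursAt-overlaps lc′ lc 0<e e<n c′-at (subst (λ i → OccursAt c i D) (+-comm e r) c-at))
    by-cases (no e≮n)  =
      inj₂ (occursAt-overlaps lc lc′ (<-≤-trans 0<r (m≤n+m r s)) (s+r<n (≮⇒≥ e≮n))
              c-at c′-at-next)

  rotations-overlap : ∀ {n m} c t c′ t′ {s s′} →
    length c ≡ n → length c′ ≡ n → length t ≡ m → length t′ ≡ m → m < n →
    s < s′ → s′ < n + m → rotate s (c ++ t) ≡ rotate s′ (c′ ++ t′) →
    Overlaps n c c′ ⊎ Overlaps n c′ c
  rotations-overlap {n} {m} c t c′ t′ {s} lc lc′ lt lt′ m<n s<s′ s′<L eq
    with m<n⇒∃[o]m+suc[o]≡n s<s′ | m<n⇒∃[o]m+suc[o]≡n s′<L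
  ... | e , refl | r , L≡ =
    distinct-rotations-overlap c t c′ t′ z<s z<s lc lc′ (subst (_< n) (sym lt) m<n)
      (length-++≡ c t lc lt) (length-++≡ c′ t′ lc′ lt′) eq
    where
    length-++≡ : ∀ u v → length u ≡ n → length v ≡ m → length (u ++ v) ≡ s + suc e + suc r
    length-++≡ u v lu lv = trans (length-++ u) (trans (cong₂ _+_ lu lv) (sym L≡))

  rotate-++-injective : ∀ {n m} c t c′ t′ {s s′} →
    ¬ Overlaps n c c′ → ¬ Overlaps n c′ c →
    length c ≡ n → length c′ ≡ n → length t ≡ m → length t′ ≡ m → m < n →
    s < n + m → s′ < n + m → rotate s (c ++ t) ≡ rotate s′ (c′ ++ t′) →
    c ≡ c′ × t ≡ t′ × s ≡ s′
  rotate-++-injective {n} {m} c t c′ t′ {s} {s′} ¬cc′ ¬c′c lc lc′ lt lt′ m<n s<L s′<L eq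
    with <-cmp s s′
  ... | tri< s<s′ _ _ =
    ⊥-elim ([ ¬cc′ , ¬c′c ] (rotations-overlap c t c′ t′ lc lc′ lt lt′ m<n s<s′ s′<L eq))
  ... | tri> _ _ s′<s =
    ⊥-elim ([ ¬c′c , ¬cc′ ] (rotations-overlap c′ t′ c t lc′ lc lt′ lt m<n s′<s s<L (sym eq)))
  ... | tri≈ _ refl _ =
    let (c≡ , t≡) = ++-injective c t c′ t′ (trans lc (sym lc′))
                      (rotate-injective (c ++ t) (c′ ++ t′) (trans (length-++≡n+m c t lc lt)
                        (sym (length-++≡n+m c′ t′ lc′ lt′)))
                        (subst (s ≤_) (sym (length-++≡n+m c t lc lt)) (<⇒≤ s<L)) eq)
    in c≡ , t≡ , refl
    where
    length-++≡n+m : ∀ u v → length u ≡ n → length v ≡ m → length (u ++ v) ≡ n + m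
    length-++≡n+m u v lu lv = trans (length-++ u) (cong₂ _+_ lu lv)

  constant-overlaps : ∀ {n a} {u : List A} → 1 < n → length u ≡ n → All (_≡ a) u →
                      Overlaps n u u
  constant-overlaps {n} {a} {u} 1<n refl u≡a = 1 , (≤-refl , 1<n) , prefix≡suffix
    where
    open ≡-Reasoning
    length-take-1 : length (take 1 u) ≡ 1
    length-take-1 = trans (length-take 1 u) (m≤n⇒m⊓n≡m (<⇒≤ 1<n))
    length-drop-n∸1 : length (drop (n ∸ 1) u) ≡ 1
    length-drop-n∸1 = trans (length-drop (n ∸ 1) u) (m∸[m∸n]≡n (<⇒≤ 1<n))
    prefix≡suffix : take 1 u ≡ drop (n ∸ 1) u
    prefix≡suffix = begin
      take 1 u                              ≡⟨ all≡⇒≡replicate (take⁺ 1 u≡a) ⟩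
      replicate (length (take 1 u)) a       ≡⟨ cong (λ k → replicate k a) length-take-1 ⟩
      replicate 1 a                         ≡⟨ cong (λ k → replicate k a) (sym length-drop-n∸1) ⟩
      replicate (length (drop (n ∸ 1) u)) a ≡⟨ sym (all≡⇒≡replicate (drop⁺ (n ∸ 1) u≡a)) ⟩
      drop (n ∸ 1) u                        ∎

  rotate-≢-replicate : ∀ {n s k a} c t → 1 < n → length c ≡ n → ¬ Overlaps n c c →
                       s ≤ length (c ++ t) → rotate s (c ++ t) ≢ replicate k a
  rotate-≢-replicate {s = s} {k} {a} c t 1<n lc ¬cc s≤ eq =
    let (p , s+p≡) = m≤n⇒∃[o]m+o≡n s≤
        c-at = occursAt-prefix t (occursAt-rotate (c ++ t) s p [] (sym s+p≡))
        X≡a  = subst (All (_≡ a)) (sym eq) (replicate⁺ k refl)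
        c≡a  = subst (All (_≡ a)) (OccursAt.window c-at)
                 (take⁺ (length c) (drop⁺ p (++⁺ X≡a (++⁺ X≡a All.[]))))
    in ¬cc (constant-overlaps 1<n lc c≡a)

remQuot-injective : ∀ {a} b {i j : Fin (a * b)} → remQuot b i ≡ remQuot b j → i ≡ j
remQuot-injective {a} b = Injection.injective (↔⇒↣ (*↔× {a} {b}))

module _ {q : ℕ} where

  decode : ∀ k → Fin (q ^ k) → List (Fin q)
  decode zero    _ = []
  decode (suc k) i = let (x , j) = remQuot (q ^ k) i in x ∷ decode k j

  length-decode : ∀ k i → length (decode k i) ≡ k
  length-decode zero    _ = refl
  length-decode (suc k) i = cong suc (length-decode k _)

  decode-injective : ∀ k {i j} → decode k i ≡ decode k j → i ≡ j
  decode-injective zero    {Fin.zero} {Fin.zero} _ = refl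
  decode-injective (suc k) eq =
    remQuot-injective (q ^ k) (cong₂ _,_ (∷-injectiveˡ eq) (decode-injective k (∷-injectiveʳ eq)))

  -- Reads the first k letters, padding with pad: injective only on words of length k.
  encode : Fin q → ∀ k → List (Fin q) → Fin (q ^ k)
  encode pad zero    _        = Fin.zero
  encode pad (suc k) []       = combine pad (encode pad k [])
  encode pad (suc k) (x ∷ xs) = combine x (encode pad k xs)

  encode-injective : ∀ pad k {xs ys} → length xs ≡ k → length ys ≡ k →
                     encode pad k xs ≡ encode pad k ys → xs ≡ ys
  encode-injective pad zero    {[]}     {[]}     _   _   _  = refl
  encode-injective pad (suc k) {x ∷ xs} {y ∷ ys} lxs lys eq =
    let (x≡y , rest) = combine-injective x _ y _ eq
    in cong₂ _∷_ x≡y (encode-injective pad k (suc-injective lxs) (suc-injective lys) rest)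

injective-missing⇒< : ∀ {a b} (f : Fin a → Fin b) → Injective _≡_ _≡_ f →
                      (y : Fin b) → (∀ i → f i ≢ y) → a < b
injective-missing⇒< {a} {b} f f-injective y y∉f = injective⇒≤ g-injective
  where
  g : Fin (suc a) → Fin b
  g Fin.zero    = y
  g (Fin.suc i) = f i
  g-injective : Injective _≡_ _≡_ g
  g-injective {Fin.zero}  {Fin.zero}  _  = refl
  g-injective {Fin.zero}  {Fin.suc j} eq = contradiction (sym eq) (y∉f j)
  g-injective {Fin.suc i} {Fin.zero}  eq = contradiction eq (y∉f i)
  g-injective {Fin.suc i} {Fin.suc j} eq = cong Fin.suc (f-injective eq)

lookup-injective : ∀ {A : Set} {xs : List A} → Unique xs →
                   ∀ i j → lookup xs i ≡ lookup xs j → i ≡ j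
lookup-injective (_  ∷ _)   Fin.zero    Fin.zero    _  = refl
lookup-injective (px ∷ _)   Fin.zero    (Fin.suc j) eq =
  contradiction eq (All.lookup px (∈-lookup j))
lookup-injective (px ∷ _)   (Fin.suc i) Fin.zero    eq =
  contradiction (sym eq) (All.lookup px (∈-lookup i))
lookup-injective (_  ∷ pxs) (Fin.suc i) (Fin.suc j) eq = cong Fin.suc (lookup-injective pxs i j eq)

module NonOverlappingBound {q n m : ℕ} (0<q : 0 < q) (1<n : 1 < n) (m<n : m < n)
  (C : List (Word q n)) (C-unique : Unique C) (C-non-overlapping : NonOverlapping C) where

  L : ℕ
  L = n + m

  pad : Fin q
  pad = fromℕ< 0<q

  codeword : Fin (length C) → List (Fin q)
  codeword i = toList (lookup C i)

  codeword-injective : ∀ {i j} → codeword i ≡ codeword j → i ≡ j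
  codeword-injective {i} {j} eq =
    lookup-injective C-unique i j (trans (sym (cast-is-id refl _)) (toList-injective refl _ _ eq))

  codewords-¬overlap : ∀ i j → ¬ Overlaps n (codeword i) (codeword j)
  codewords-¬overlap i j (k , bounds , eq) =
    C-non-overlapping _ _ (∈-lookup i) (∈-lookup j) (k , bounds , inj₁ eq)

  Index : Set
  Index = (Fin (length C) × Fin L) × Fin (q ^ m)

  split : Fin (length C * L * q ^ m) → Index
  split k = map₁ (remQuot L) (remQuot (q ^ m) k)

  split-injective : Injective _≡_ _≡_ split
  split-injective eq =
    remQuot-injective {length C * L} (q ^ m)
      (cong₂ _,_ (remQuot-injective {length C} L (cong proj₁ eq)) (cong proj₂ eq))

  glued : Fin (length C) → Fin (q ^ m) → List (Fin q)
  glued i r = codeword i ++ decode m r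

  length-glued : ∀ i r → length (glued i r) ≡ L
  length-glued i r =
    trans (length-++ (codeword i)) (cong₂ _+_ (length-toList (lookup C i)) (length-decode m r))

  rotatedWord : Index → List (Fin q)
  rotatedWord ((i , s) , r) = rotate (toℕ s) (glued i r)

  length-rotatedWord : ∀ x → length (rotatedWord x) ≡ L
  length-rotatedWord ((i , s) , r) = trans (length-rotate (toℕ s) (glued i r)) (length-glued i r)

  rotatedWord-injective : Injective _≡_ _≡_ rotatedWord
  rotatedWord-injective {(i , s) , r} {(i′ , s′) , r′} eq =
    let (c≡ , t≡ , s≡) = rotate-++-injective (codeword i) (decode m r) (codeword i′) (decode m r′)
                           (codewords-¬overlap i i′) (codewords-¬overlap i′ i)
                           (length-toList (lookup C i)) (length-toList (lookup C i′))
                           (length-decode m r) (length-decode m r′) m<n (toℕ<n s) (toℕ<n s′) eq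
    in cong₂ _,_ (cong₂ _,_ (codeword-injective c≡) (toℕ-injective s≡)) (decode-injective m t≡)

  rotatedWord-non-constant : ∀ x → rotatedWord x ≢ replicate L pad
  rotatedWord-non-constant ((i , s) , r) =
    rotate-≢-replicate (codeword i) (decode m r) 1<n (length-toList (lookup C i))
      (codewords-¬overlap i i) (subst (toℕ s ≤_) (sym (length-glued i r)) (<⇒≤ (toℕ<n s)))

  embedding : Fin (length C * L * q ^ m) → Fin (q ^ L)
  embedding k = encode pad L (rotatedWord (split k))

  embedding-injective : Injective _≡_ _≡_ embedding
  embedding-injective {k} {k′} eq = split-injective (rotatedWord-injective
    (encode-injective pad L (length-rotatedWord (split k)) (length-rotatedWord (split k′)) eq))

  embedding-misses-constant : ∀ k → embedding k ≢ encode pad L (replicate L pad)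
  embedding-misses-constant k eq = rotatedWord-non-constant (split k)
    (encode-injective pad L (length-rotatedWord (split k)) (length-replicate L) eq)

  length*[n+m]<q^n : length C * L < q ^ n
  length*[n+m]<q^n = *-cancelʳ-< (q ^ m) (length C * L) (q ^ n)
    (subst (length C * L * q ^ m <_) (^-distribˡ-+-* q n m)
      (injective-missing⇒< embedding embedding-injective _ embedding-misses-constant))

theorem1 : (n q : ℕ) → 2 ≤ n → 2 ≤ q →
    (C : List (Word q n)) → Unique C → NonOverlapping C →
    length C * (2 * n ∸ 1) < q ^ n
theorem1 n q 2≤n 2≤q C C-unique C-non-overlapping =
  subst (λ L → length C * L < q ^ n) (sym 2n∸1≡n+[n∸1])
    (NonOverlappingBound.length*[n+m]<q^n (<-trans z<s 2≤q) 2≤n n∸1<n C C-unique C-non-overlapping)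
  where
  1≤n : 1 ≤ n
  1≤n = <⇒≤ 2≤n
  n∸1<n : n ∸ 1 < n
  n∸1<n = ∸-monoʳ-< z<s 1≤n
  2n∸1≡n+[n∸1] : 2 * n ∸ 1 ≡ n + (n ∸ 1)
  2n∸1≡n+[n∸1] = trans (cong (λ k → (n + k) ∸ 1) (+-identityʳ n)) (+-∸-assoc n 1≤n)
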